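{- Let $k \ge 4$ and let $G$ be an $SQSR(n, k, 0; k-1, k-2, k-3)$ graph. Then $n - k - 1 \geq k+1$ (i.e. for any vertex $u$, the graph $G - N[u]$ has at least $k+1$ vertices).
   Context: All graphs are finite and simple. $N[u]$ is the closed neighbourhood of $u$. A $QSR(n,k,a;c_1,\ldots,c_p)$ graph is a $k$-regular graph on $n$ vertices such that any two adjacent vertices have exactly $a$ common neighbours and any two distinct non-adjacent vertices have exactly $c_i$ common neighbours for some $1 \le i \le p$. Its grade is the number of indices $i$ for which there actually exist two non-adjacent vertices with exactly $c_i$ common neighbours; it is proper if its grade is $p$. An $SQSR(n,k,a;c_1,\ldots,c_p)$ graph is a proper $QSR(n,k,a;c_1,\ldots,c_p)$ graph in which $a, c_1, \ldots, c_p$ are pairwise distinct. -}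

module Defs where

open import Data.Nat using (ℕ; _≤_)
open import Data.Bool using (Bool; true; false; _∧_; T)
open import Data.Fin using (Fin)
open import Data.List using (List; length; filter)
open import Data.List.Base using (allFin)
open import Data.Product using (Σ; ∃; ∃-syntax; _×_)
open import Relation.Binary.PropositionalEquality using (_≡_)
open import Relation.Nullary using (¬_)
open import Relation.Nullary.Decidable using (does)
open import Data.Bool.Properties using (T?)

record Graph (n : ℕ) : Set where
  field
    adj    : Fin n → Fin n → Bool
    sym    : ∀ u v → adj u v ≡ adj v u
    irrefl : ∀ u → adj u u ≡ false

open Graph public

countV : {n : ℕ} → (Fin n → Bool) → ℕ
countV {n} P = length (filter (λ w → T? (P w)) (allFin n))

deg : {n : ℕ} → Graph n → Fin n → ℕ
deg G u = countV (λ w → adj G u w)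

common : {n : ℕ} → Graph n → Fin n → Fin n → ℕ
common G u v = countV (λ w → adj G u w ∧ adj G v w)

Adjacent : {n : ℕ} → Graph n → Fin n → Fin n → Set
Adjacent G u v = adj G u v ≡ true

QSR : (n k a p : ℕ) → (Fin p → ℕ) → Graph n → Set
QSR n k a p c G =
    (∀ u → deg G u ≡ k)
  × (∀ u v → Adjacent G u v → common G u v ≡ a)
  × (∀ u v → ¬ u ≡ v → ¬ Adjacent G u v → ∃[ i ] common G u v ≡ c i)

-- every c_i is realised by some pair of distinct non-adjacent vertices (grade = p)
Proper : (n p : ℕ) → (Fin p → ℕ) → Graph n → Set
Proper n p c G =
  ∀ i → ∃[ u ] ∃[ v ] (¬ u ≡ v × ¬ Adjacent G u v × common G u v ≡ c i)

SQSR : (n k a p : ℕ) → (Fin p → ℕ) → Graph n → Set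
SQSR n k a p c G =
    QSR n k a p c G
  × Proper n p c G
  × (∀ i → ¬ a ≡ c i)
  × (∀ i j → c i ≡ c j → i ≡ j)

{-# OPTIONS --safe #-}
module Submission where

-- Properness yields u, v with k - 2 common neighbours; let w be one of them.
-- Since a = 0, the neighbourhoods N(u) and N(w) are disjoint, and N(v) meets
-- N(w) nowhere; so N(u), N(w) and N(v) ∖ N(u) are pairwise disjoint sets of
-- sizes k, k and 2, and n ≥ 2k + 2.

open import Defs hiding (sym)
open import Data.Nat using (ℕ; zero; suc; _+_; _∸_; _≤_; _<_; z≤n; s≤s)
open import Data.Nat.Properties
open import Data.Nat.Tactic.RingSolver using (solve-∀)
open import Algebra.Properties.CommutativeSemigroup +-commutativeSemigroup using (x∙yz≈y∙xz)
open import Data.Fin using (Fin; zero; suc)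
open import Data.Vec.Functional using (_∷_; [])
open import Data.Bool using (Bool; true; false; _∧_; _∨_; not; T)
open import Data.Bool.Properties using (T?)
open import Data.List as List using (List; length; filter)
open import Data.List.Base using (allFin)
open import Data.List.Properties using (length-filter; length-tabulate)
open import Data.Product using (∃-syntax; _×_; _,_)
open import Data.Unit using (tt)
open import Data.Empty using (⊥-elim)
open import Relation.Binary.PropositionalEquality

module _ {A : Set} where

  count : (A → Bool) → List A → ℕ
  count P xs = length (filter (λ x → T? (P x)) xs)

  count-∨-+-count-∧ : (P Q : A → Bool) (xs : List A) →
    count (λ x → P x ∨ Q x) xs + count (λ x → P x ∧ Q x) xs ≡ count P xs + count Q xs
  count-∨-+-count-∧ P Q List.[] = refl
  count-∨-+-count-∧ P Q (x List.∷ xs) with P x | Q x | count-∨-+-count-∧ P Q xs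
  ... | true  | true  | ih = cong suc (trans (+-suc _ _) (trans (cong suc ih) (sym (+-suc _ _))))
  ... | true  | false | ih = cong suc ih
  ... | false | true  | ih = trans (cong suc ih) (sym (+-suc _ _))
  ... | false | false | ih = ih

  count-∨-disjoint : (P Q : A → Bool) (xs : List A) → count (λ x → P x ∧ Q x) xs ≡ 0 →
    count (λ x → P x ∨ Q x) xs ≡ count P xs + count Q xs
  count-∨-disjoint P Q xs disjoint = begin
    count (λ x → P x ∨ Q x) xs                                  ≡⟨ sym (+-identityʳ _) ⟩
    count (λ x → P x ∨ Q x) xs + 0                              ≡⟨ cong (count (λ x → P x ∨ Q x) xs +_) (sym disjoint) ⟩
    count (λ x → P x ∨ Q x) xs + count (λ x → P x ∧ Q x) xs     ≡⟨ count-∨-+-count-∧ P Q xs ⟩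
    count P xs + count Q xs                                     ∎
    where open ≡-Reasoning

  count-split : (P Q : A → Bool) (xs : List A) →
    count Q xs ≡ count (λ x → P x ∧ Q x) xs + count (λ x → not (P x) ∧ Q x) xs
  count-split P Q List.[] = refl
  count-split P Q (x List.∷ xs) with P x | Q x | count-split P Q xs
  ... | true  | true  | ih = cong suc ih
  ... | false | true  | ih = trans (cong suc ih) (sym (+-suc _ _))
  ... | true  | false | ih = ih
  ... | false | false | ih = ih

  count-mono : (P Q : A → Bool) → (∀ x → T (P x) → T (Q x)) → (xs : List A) →
    count P xs ≤ count Q xs
  count-mono P Q P⇒Q List.[] = z≤n
  count-mono P Q P⇒Q (x List.∷ xs) with P x in p | Q x in q
  ... | true  | true  = s≤s (count-mono P Q P⇒Q xs)
  ... | true  | false = ⊥-elim (subst T q (P⇒Q x (subst T (sym p) tt)))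
  ... | false | true  = m≤n⇒m≤1+n (count-mono P Q P⇒Q xs)
  ... | false | false = count-mono P Q P⇒Q xs

  count-pos⇒witness : (P : A → Bool) (xs : List A) → 0 < count P xs → ∃[ x ] P x ≡ true
  count-pos⇒witness P (x List.∷ xs) pos with P x in p
  ... | true  = x , p
  ... | false = count-pos⇒witness P xs pos

countV≤n : {n : ℕ} (P : Fin n → Bool) → countV P ≤ n
countV≤n {n} P = ≤-trans (length-filter (λ x → T? (P x)) (allFin n)) (≤-reflexive (length-tabulate (λ i → i)))

∧-true : ∀ {a b} → a ∧ b ≡ true → a ≡ true × b ≡ true
∧-true {true} {true} _ = refl , refl

module _ {n : ℕ} (G : Graph n) where

  common-pos⇒common-neighbour : ∀ u v → 0 < common G u v →
    ∃[ w ] Adjacent G u w × Adjacent G v w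
  common-pos⇒common-neighbour u v pos with count-pos⇒witness _ (allFin n) pos
  ... | w , uw∧vw = w , ∧-true uw∧vw

  deg+deg+deg≤n+common : ∀ u v w → common G u w ≡ 0 → common G w v ≡ 0 →
    deg G u + deg G w + deg G v ≤ n + common G u v
  deg+deg+deg≤n+common u v w uw≡0 wv≡0 = begin
    deg G u + deg G w + deg G v        ≡⟨ cong₂ _+_ (sym (count-∨-disjoint Nu Nw (allFin n) uw≡0))
                                                    (count-split Nu Nv (allFin n)) ⟩
    ∣Nu∪Nw∣ + (c + ∣Nv∖Nu∣)            ≡⟨ x∙yz≈y∙xz ∣Nu∪Nw∣ c ∣Nv∖Nu∣ ⟩
    c + (∣Nu∪Nw∣ + ∣Nv∖Nu∣)            ≡⟨ cong (c +_) (sym (count-∨-disjoint Nu∪Nw Nv∖Nu (allFin n) separated)) ⟩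
    c + countV (λ x → Nu∪Nw x ∨ Nv∖Nu x) ≤⟨ +-monoʳ-≤ c (countV≤n _) ⟩
    c + n                              ≡⟨ +-comm c n ⟩
    n + c                              ∎
    where
    open ≤-Reasoning
    Nu Nv Nw Nu∪Nw Nv∖Nu : Fin n → Bool
    Nu = adj G u
    Nv = adj G v
    Nw = adj G w
    Nu∪Nw x = Nu x ∨ Nw x
    Nv∖Nu x = not (Nu x) ∧ Nv x

    c ∣Nu∪Nw∣ ∣Nv∖Nu∣ : ℕ
    c = common G u v
    ∣Nu∪Nw∣ = countV Nu∪Nw
    ∣Nv∖Nu∣ = countV Nv∖Nu

    meet⊆Nw∩Nv : ∀ x → T (Nu∪Nw x ∧ Nv∖Nu x) → T (Nw x ∧ Nv x)
    meet⊆Nw∩Nv x with Nu x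
    ... | true  = λ ()
    ... | false = λ Nw∧Nv → Nw∧Nv

    separated : countV (λ x → Nu∪Nw x ∧ Nv∖Nu x) ≡ 0
    separated = n≤0⇒n≡0 (subst (countV (λ x → Nu∪Nw x ∧ Nv∖Nu x) ≤_) wv≡0
      (count-mono (λ x → Nu∪Nw x ∧ Nv∖Nu x) (λ x → Nw x ∧ Nv x) meet⊆Nw∩Nv (allFin n)))

3k≤n+[k∸2]⇒k+1≤n∸k∸1 : ∀ {k n} → 2 ≤ k → k + k + k ≤ n + (k ∸ 2) → k + 1 ≤ n ∸ k ∸ 1
3k≤n+[k∸2]⇒k+1≤n∸k∸1 {suc (suc j)} {n} (s≤s (s≤s _)) 3k≤n+j = begin
  suc (suc j) + 1           ≤⟨ m+n≤o⇒m≤o∸n (suc (suc j) + 1) 2k+2≤n ⟩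
  n ∸ (suc (suc j) + 1)     ≡⟨ sym (∸-+-assoc n (suc (suc j)) 1) ⟩
  n ∸ suc (suc j) ∸ 1       ∎
  where
  open ≤-Reasoning
  regroup : ∀ j → suc (suc j) + suc (suc j) + suc (suc j) ≡ suc (suc j) + 1 + (suc (suc j) + 1) + j
  regroup = solve-∀
  2k+2≤n : suc (suc j) + 1 + (suc (suc j) + 1) ≤ n
  2k+2≤n = +-cancelʳ-≤ j _ n (subst (_≤ n + j) (regroup j) 3k≤n+j)

mainTheorem11 : (n k : ℕ) → 4 ≤ k → (G : Graph n)
    → SQSR n k 0 3 (k ∸ 1 ∷ k ∸ 2 ∷ k ∸ 3 ∷ []) G
    → k + 1 ≤ n ∸ k ∸ 1
mainTheorem11 n k 4≤k G ((deg≡k , adjacent⇒common≡0 , _) , proper , _)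
  with proper (suc zero)
... | u , v , _ , _ , common≡k∸2
  with common-pos⇒common-neighbour G u v
         (subst (0 <_) (sym common≡k∸2) (<-≤-trans (s≤s z≤n) (∸-monoˡ-≤ 2 4≤k)))
... | w , u~w , v~w = 3k≤n+[k∸2]⇒k+1≤n∸k∸1 (≤-trans (s≤s (s≤s z≤n)) 4≤k)
  (subst₂ (λ d c → d ≤ n + c) degrees common≡k∸2 (deg+deg+deg≤n+common G u v w uw≡0 wv≡0))
  where
  uw≡0 : common G u w ≡ 0
  uw≡0 = adjacent⇒common≡0 u w u~w
  wv≡0 : common G w v ≡ 0
  wv≡0 = adjacent⇒common≡0 w v (trans (Graph.sym G w v) v~w)
  degrees : deg G u + deg G w + deg G v ≡ k + k + k
  degrees = cong₂ _+_ (cong₂ _+_ (deg≡k u) (deg≡k w)) (deg≡k v)
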